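{- Let $G$ and $H$ be connected graphs with $|V(G)| \ge 2$. If $M$ is a mutual-visibility set of $G \odot H$ and $h_u, h_v \in M$, where $h_u \in V(H_u)$, $h_v \in V(H_v)$ and $u \neq v$ are vertices of $G$, then $\{u,v\} \cap M = \emptyset$.
   Context: All graphs are finite, simple, undirected and connected. For a graph $G$ and $X \subseteq V(G)$, two vertices $u,v$ are $X$-visible if there exists a shortest $(u,v)$-path $P$ in $G$ with $V(P)\cap X \subseteq \{u,v\}$. A set $X\subseteq V(G)$ is a mutual-visibility set of $G$ if every two vertices of $X$ are $X$-visible. The corona $G\odot H$ is obtained from one copy of $G$ and $|V(G)|$ copies of $H$, the copy associated with $v\in V(G)$ being denoted $H_v$, by joining each $v \in V(G)$ to every vertex of $H_v$. -}

module Defs where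

open import Data.Nat using (ℕ; _≤_)
open import Data.Fin using (Fin)
open import Data.List using (List; []; _∷_; length)
open import Data.List.Membership.Propositional using (_∈_)
open import Data.List.Relation.Unary.Unique.Propositional using (Unique)
open import Data.Product using (Σ; ∃; _×_; _,_)
open import Data.Sum using (_⊎_; inj₁; inj₂)
open import Data.Empty using (⊥)
open import Relation.Nullary using (¬_)
open import Relation.Binary.PropositionalEquality using (_≡_; refl; sym)

record Graph (V : Set) : Set₁ where
  field
    Adj    : V → V → Set
    adj-sym : ∀ {x y} → Adj x y → Adj y x
    irrefl : ∀ {x} → ¬ Adj x x
open Graph public

module _ {V : Set} (G : Graph V) where

  data IsWalk : List V → V → V → Set where
    single : ∀ {u} → IsWalk (u ∷ []) u u
    step   : ∀ {u w v p} → Adj G u w → IsWalk (w ∷ p) w v → IsWalk (u ∷ w ∷ p) u v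

  IsPath : List V → V → V → Set
  IsPath p u v = IsWalk p u v × Unique p

  IsShortestPath : List V → V → V → Set
  IsShortestPath p u v = IsPath p u v × (∀ q → IsPath q u v → length p ≤ length q)

  Connected : Set
  Connected = ∀ u v → ∃ λ p → IsPath p u v

  Visible : (V → Set) → V → V → Set
  Visible X u v = ∃ λ p → IsShortestPath p u v × (∀ x → x ∈ p → X x → x ≡ u ⊎ x ≡ v)

  IsMutualVisibilitySet : (V → Set) → Set
  IsMutualVisibilitySet X = ∀ u v → X u → X v → Visible X u v

-- Corona G ⊙ H: vertices inj₁ g (copy of G) and inj₂ (g , h) (vertex h of H_g).
module _ {A B : Set} (G : Graph A) (H : Graph B) where

  CAdj : A ⊎ (A × B) → A ⊎ (A × B) → Set
  CAdj (inj₁ a) (inj₁ b) = Adj G a b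
  CAdj (inj₁ a) (inj₂ (b , _)) = a ≡ b
  CAdj (inj₂ (a , _)) (inj₁ b) = a ≡ b
  CAdj (inj₂ (a , h)) (inj₂ (b , k)) = a ≡ b × Adj H h k

  private
    csym : ∀ {x y} → CAdj x y → CAdj y x
    csym {inj₁ a} {inj₁ b} e = Graph.adj-sym G e
    csym {inj₁ a} {inj₂ _} e = sym e
    csym {inj₂ _} {inj₁ b} e = sym e
    csym {inj₂ _} {inj₂ _} (e , f) = sym e , Graph.adj-sym H f

    cirr : ∀ {x} → ¬ CAdj x x
    cirr {inj₁ a} e = Graph.irrefl G e
    cirr {inj₂ _} (_ , f) = Graph.irrefl H f

  corona : Graph (A ⊎ (A × B))
  corona = record { Adj = CAdj ; adj-sym = λ {x} {y} → csym {x} {y} ; irrefl = λ {x} → cirr {x} }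

{-# OPTIONS --safe #-}
module Submission where

open import Defs
open import Data.Nat using (_≤_)
open import Data.Fin using (Fin)
open import Data.Product using (_×_; _,_)
open import Data.Sum using (_⊎_; inj₁; inj₂)
open import Data.Empty using (⊥-elim)
open import Data.List.Membership.Propositional using (_∈_)
open import Data.List.Relation.Unary.Any using (here; there)
open import Function using (_∘_)
open import Relation.Nullary using (¬_)
open import Relation.Binary.PropositionalEquality using (_≢_; refl; sym)

-- The only neighbours of a vertex of H_u outside H_u are u itself, so every walk
-- from H_u to H_v passes through u, and u ∈ M would block the visibility of h_u and h_v.

module _ {A B : Set} (G : Graph A) (H : Graph B) where

  walk-between-fibers-visits-root : ∀ {u v h k p} → u ≢ v
    → IsWalk (corona G H) p (inj₂ (u , h)) (inj₂ (v , k)) → inj₁ u ∈ p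
  walk-between-fibers-visits-root u≢v single = ⊥-elim (u≢v refl)
  walk-between-fibers-visits-root u≢v (step {w = inj₁ _} refl _) = there (here refl)
  walk-between-fibers-visits-root u≢v (step {w = inj₂ _} (refl , _) walk) =
    there (walk-between-fibers-visits-root u≢v walk)

  root-blocks-visibility : ∀ {X : A ⊎ (A × B) → Set} {u v h k} → u ≢ v → X (inj₁ u)
    → ¬ Visible (corona G H) X (inj₂ (u , h)) (inj₂ (v , k))
  root-blocks-visibility {u = u} u≢v Xu (_ , ((walk , _) , _) , avoids)
    with avoids (inj₁ u) (walk-between-fibers-visits-root u≢v walk) Xu
  ... | inj₁ ()
  ... | inj₂ ()

mainTheorem5 : ∀ {n m} (G : Graph (Fin n)) (H : Graph (Fin m))
    → Connected G → Connected H → 2 ≤ n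
    → (M : Fin n ⊎ (Fin n × Fin m) → Set)
    → IsMutualVisibilitySet (corona G H) M
    → (u v : Fin n) → u ≢ v → (hu hv : Fin m)
    → M (inj₂ (u , hu)) → M (inj₂ (v , hv))
    → ¬ M (inj₁ u) × ¬ M (inj₁ v)
mainTheorem5 G H _ _ _ M visible u v u≢v hu hv Mhu Mhv =
    (λ Mu → root-blocks-visibility G H u≢v Mu (visible _ _ Mhu Mhv))
  , (λ Mv → root-blocks-visibility G H (u≢v ∘ sym) Mv (visible _ _ Mhv Mhu))
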